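{- Let $k\in\mathbb{N}$ and let $(T,L,c,r)$ be a rooted shadow-complete WDTAP instance of visible width at most $k$. Let $F\subseteq L$ be a shadow-minimal feasible solution, meaning that no link of $F$ can be replaced by a strict shadow of it without destroying feasibility. Then $F$ is $2k$-thin, i.e., for every $v\in V$, $|\{\ell\in F: v \text{ is an inner vertex of } P_\ell\}|\le 2k$.
   Context: WDTAP instance: oriented tree $T=(V,A)$, links $L\subseteq V\times V$, costs $c\colon L\to\mathbb{R}_{>0}$. For $\ell=(u,v)$, $P_\ell$ is the $u$-$v$ path in the underlying undirected tree traversed from $u$ to $v$; $\overrightarrow{\mathrm{cov}}(\ell)$ (arcs covered by $\ell$) is the set of arcs of $P_\ell$ traversed against their orientation. Feasible: every arc is covered. A shadow of $\ell=(u,v)$ is a link $(u',v')$ with $u',v'$ on $P_\ell$, $u'$ before $v'$ from $u$ to $v$; a strict shadow is a shadow different from $\ell$. Shadow-complete: every shadow of every $\ell\in L$ is in $L$ with cost at most $c(\ell)$. Rooted: root $r$; up-arcs point towards $r$, down-arcs away; $T_v=(U_v,A_v)$ is the subtree of descendants of $v$. $\overline{P}_\ell$ is the shortest subpath of $P_\ell$ containing all arcs of $\overrightarrow{\mathrm{cov}}(\ell)$. An arc $a\in A_v$ is visible to $v$ (w.r.t. $L$) if some $\ell\in L$ has $a\in\overrightarrow{\mathrm{cov}}(\ell)$ and $v$ is an inner vertex of $\overline{P}_\ell$. For an arc $a$, $\mathrm{apex}(a)$ is its endpoint closer to $r$; $F'\subseteq A$ is ancestor-free if no $a,a'\in F'$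 have $a'$ on the $\mathrm{apex}(a)$-$r$ path. The visible up-width (down-width) at $v$ is the maximum size of an ancestor-free set of up-arcs (down-arcs) visible to $v$; the visible width of the instance is the maximum of these over all vertices.
   Formalization: The link costs c take positive rational values rather than positive real values. -}

module Defs where

open import Data.Nat using (ℕ; zero; suc; _+_; _*_; _∸_; _≤_; _<_)
open import Data.Fin using (Fin)
open import Data.Bool using (Bool; true; false)
open import Data.Product using (Σ; ∃; _×_; _,_; proj₁; proj₂)
open import Data.Sum using (_⊎_)
open import Data.List using (List; length)
open import Data.List.Membership.Propositional using (_∈_)
open import Data.List.Relation.Unary.All using (All)
open import Data.List.Relation.Unary.Unique.Propositional using (Unique)
open import Data.Rational as ℚ using (ℚ)
open import Relation.Binary.PropositionalEquality using (_≡_; _≢_)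
open import Relation.Nullary using (¬_)

-- The depth function witnesses that following parents from any vertex reaches
-- the root (so the structure is a tree rooted at 'root'); 'parent root' is
-- irrelevant.  Every non-root vertex v determines exactly one arc of the tree,
-- namely the arc between v and 'parent v'; we identify that arc with v.
-- 'towardRoot v ≡ true' means the arc is oriented v → parent v (an up-arc),
-- 'false' means parent v → v (a down-arc).
record RootedOrientedTree (n : ℕ) : Set where
  field
    root         : Fin n
    parent       : Fin n → Fin n
    depth        : Fin n → ℕ
    depth-root   : depth root ≡ 0
    depth-parent : ∀ v → v ≢ root → depth v ≡ suc (depth (parent v))
    towardRoot   : Fin n → Bool

Link : ℕ → Set
Link n = Fin n × Fin n

module _ {n : ℕ} (T : RootedOrientedTree n) where
  open RootedOrientedTree T

  data Anc (x : Fin n) : Fin n → Set where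
    anc-refl : Anc x x
    anc-step : ∀ {y} → y ≢ root → Anc x (parent y) → Anc x y

  IsLCA : Fin n → Fin n → Fin n → Set
  IsLCA m u v = Anc m u × Anc m v × (∀ c → Anc c u → Anc c v → Anc c m)

  -- PathPos ℓ w p : w lies on P_ℓ at distance p from the start u of ℓ = (u , v).
  PathPos : Link n → Fin n → ℕ → Set
  PathPos (u , v) w p = Σ (Fin n) λ m → IsLCA m u v ×
    ((Anc m w × Anc w u × p ≡ depth u ∸ depth w)
     ⊎ (Anc m w × Anc w v × p ≡ (depth u ∸ depth m) + (depth w ∸ depth m)))

  OnPath : Link n → Fin n → Set
  OnPath ℓ w = ∃ λ p → PathPos ℓ w p

  InnerP : Link n → Fin n → Set
  InnerP ℓ w = OnPath ℓ w × w ≢ proj₁ ℓ × w ≢ proj₂ ℓ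

  -- a ∈ cov(ℓ): the arc a lies on P_ℓ and is traversed against its orientation.
  -- On the u-side (below the lca, ancestor of u) the arc is traversed a → parent a;
  -- on the v-side it is traversed parent a → a.
  Covers : Link n → Fin n → Set
  Covers (u , v) a = a ≢ root × Σ (Fin n) λ m → IsLCA m u v ×
    ((Anc a u × a ≢ m × Anc m a × towardRoot a ≡ false)
     ⊎ (Anc a v × a ≢ m × Anc m a × towardRoot a ≡ true))

  -- w is an inner vertex of \overline{P}_ℓ, the shortest subpath of P_ℓ
  -- containing all covered arcs: some covered arc lies (weakly) before w and
  -- some covered arc lies (weakly) after w along P_ℓ.
  InnerPbar : Link n → Fin n → Set
  InnerPbar ℓ w = Σ (Fin n) λ a₁ → Σ (Fin n) λ a₂ →
    Σ ℕ λ pw → Σ ℕ λ p₁ → Σ ℕ λ q₁ → Σ ℕ λ p₂ → Σ ℕ λ q₂ →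
      Covers ℓ a₁ × Covers ℓ a₂ × PathPos ℓ w pw ×
      PathPos ℓ a₁ p₁ × PathPos ℓ (parent a₁) q₁ × p₁ ≤ pw × q₁ ≤ pw ×
      PathPos ℓ a₂ p₂ × PathPos ℓ (parent a₂) q₂ × pw ≤ p₂ × pw ≤ q₂

  Visible : (Link n → Set) → Fin n → Fin n → Set
  Visible L v a = a ≢ root × Anc v a × a ≢ v ×
    Σ (Link n) λ ℓ → L ℓ × Covers ℓ a × InnerPbar ℓ v

  -- No arc of S lies on the apex(a)-root path for a ∈ S (apex a = parent a).
  AncestorFree : List (Fin n) → Set
  AncestorFree S = ∀ a a' → a ∈ S → a' ∈ S → ¬ Anc a' (parent a)

  VisibleWidthAtMost : (Link n → Set) → ℕ → Set
  VisibleWidthAtMost L k = ∀ v (S : List (Fin n)) → Unique S → AncestorFree S →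
    (All (λ a → Visible L v a × towardRoot a ≡ true) S
     ⊎ All (λ a → Visible L v a × towardRoot a ≡ false) S) →
    length S ≤ k

  Feasible : (Link n → Set) → Set
  Feasible F = ∀ a → a ≢ root → Σ (Link n) λ ℓ → F ℓ × Covers ℓ a

  Shadow : Link n → Link n → Set
  Shadow ℓ ℓ' = Σ ℕ λ p → Σ ℕ λ q →
    PathPos ℓ (proj₁ ℓ') p × PathPos ℓ (proj₂ ℓ') q × p < q

  ShadowComplete : (Link n → Set) → (Link n → ℚ) → Set
  ShadowComplete L c = ∀ ℓ ℓ' → L ℓ → Shadow ℓ ℓ' → L ℓ' × c ℓ' ℚ.≤ c ℓ

  ShadowMinimal : (Link n → Set) → (Link n → Set) → Set
  ShadowMinimal L F = ∀ ℓ ℓ' → F ℓ → L ℓ' → Shadow ℓ ℓ' → ℓ' ≢ ℓ →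
    ¬ Feasible (λ m → (F m × m ≢ ℓ) ⊎ m ≡ ℓ')

  Thin : (Link n → Set) → ℕ → Set
  Thin F t = ∀ v (S : List (Link n)) → Unique S →
    All (λ ℓ → F ℓ × InnerP ℓ v) S → length S ≤ t

{-# OPTIONS --safe #-}
module Submission where

-- Let ℓ = (u , w) ∈ F have v as an inner vertex, say with u below v.  Replacing ℓ
-- by the strict shadow that starts one vertex later loses only the first arc of
-- P_ℓ, so by shadow-minimality that arc is covered by ℓ and by no other link of F.
-- Hence it is a down-arc visible to v (the last arc of P_ℓ is covered by ℓ for the
-- same reason, so v is inner in the covered part of P_ℓ), and for two such links
-- neither first arc lies above the other: the link starting lower would cover it
-- too.  The first arcs thus form an ancestor-free set of visible down-arcs, of size
-- at most k; symmetrically, the last arcs of the links ending below v form one of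
-- visible up-arcs.

open import Defs
open import Data.Nat using (ℕ; suc; _+_; _*_; _∸_; _≤_; _<_; s≤s)
open import Data.Nat.Properties hiding (_≟_)
open import Data.Fin using (Fin; _≟_)
open import Data.Bool using (false; true) renaming (_≟_ to _≟ᵇ_)
open import Data.Product using (Σ; _×_; _,_; proj₁; proj₂)
open import Data.Product.Properties using (≡-dec)
open import Data.Sum using (_⊎_; inj₁; inj₂)
open import Data.Empty using (⊥-elim)
open import Data.List using (List; []; _∷_; length; map)
open import Data.List.Properties using (length-map)
open import Data.List.Membership.Propositional.Properties using (∈-map⁻)
open import Data.List.Relation.Unary.All as All using (All; []; _∷_)
open import Data.List.Relation.Unary.All.Properties using () renaming (map⁺ to All-map⁺)
open import Data.List.Relation.Unary.AllPairs using ([]; _∷_)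
open import Data.List.Relation.Unary.Unique.Propositional using (Unique)
open import Data.List.Relation.Binary.Sublist.Propositional using (_⊆_; _⊇_; []; _∷_; _∷ʳ_)
open import Data.List.Relation.Binary.Sublist.Propositional.Properties using (All-resp-⊆)
open import Data.Rational using (ℚ; 0ℚ) renaming (_<_ to _<ℚ_)
open import Function using (_∘_)
open import Relation.Binary.Definitions using (_Respects_)
open import Relation.Binary.PropositionalEquality
open import Relation.Nullary using (¬_; yes; no)
open import Relation.Nullary.Decidable using (decidable-stable)

2≤∸ : ∀ {a b c} → a < b → b < c → 2 ≤ c ∸ a
2≤∸ {a} {c = c} a<b b<c = subst (_≤ c ∸ a) (m+n∸n≡m 2 a) (∸-monoˡ-≤ a (≤-trans (s≤s a<b) b<c))

m∸n≡suc[m∸suc[n]] : ∀ {m n} → n < m → m ∸ n ≡ suc (m ∸ suc n)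
m∸n≡suc[m∸suc[n]] {suc m} (s≤s n≤m) = +-∸-assoc 1 n≤m

Unique-resp-⊆ : ∀ {A : Set} → (Unique {A = A}) Respects _⊇_
Unique-resp-⊆ [] [] = []
Unique-resp-⊆ (_ ∷ʳ ys⊆xs) (_ ∷ uniq) = Unique-resp-⊆ ys⊆xs uniq
Unique-resp-⊆ (refl ∷ ys⊆xs) (x∉xs ∷ uniq) = All-resp-⊆ ys⊆xs x∉xs ∷ Unique-resp-⊆ ys⊆xs uniq

record Split {A : Set} (P Q : A → Set) (xs : List A) : Set where
  field
    lefts rights : List A
    lefts⊆       : lefts ⊆ xs
    rights⊆      : rights ⊆ xs
    all-lefts    : All P lefts
    all-rights   : All Q rights
    length-split : length xs ≡ length lefts + length rights

split : ∀ {A : Set} {P Q : A → Set} xs → All (λ x → P x ⊎ Q x) xs → Split P Q xs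
split [] [] = record
  { lefts = [] ; rights = [] ; lefts⊆ = [] ; rights⊆ = []
  ; all-lefts = [] ; all-rights = [] ; length-split = refl }
split (x ∷ xs) (inj₁ px ∷ pxs) = record
  { lefts = x ∷ lefts ; rights = rights ; lefts⊆ = refl ∷ lefts⊆ ; rights⊆ = x ∷ʳ rights⊆
  ; all-lefts = px ∷ all-lefts ; all-rights = all-rights ; length-split = cong suc length-split }
  where open Split (split xs pxs)
split (x ∷ xs) (inj₂ qx ∷ pxs) = record
  { lefts = lefts ; rights = x ∷ rights ; lefts⊆ = x ∷ʳ lefts⊆ ; rights⊆ = refl ∷ rights⊆
  ; all-lefts = all-lefts ; all-rights = qx ∷ all-rights
  ; length-split = trans (cong suc length-split) (sym (+-suc (length lefts) (length rights))) }
  where open Split (split xs pxs)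

module Ancestry {n : ℕ} (T : RootedOrientedTree n) where
  open RootedOrientedTree T

  depth-parent< : ∀ {b} → b ≢ root → depth (parent b) < depth b
  depth-parent< {b} b≢r = ≤-reflexive (sym (depth-parent b b≢r))

  depth-parent∸ : ∀ {b d} → b ≢ root → d ≤ depth (parent b) →
                  depth b ∸ d ≡ suc (depth (parent b) ∸ d)
  depth-parent∸ {b} {d} b≢r d≤ = trans (cong (_∸ d) (depth-parent b b≢r)) (+-∸-assoc 1 d≤)

  depth-parent∸self : ∀ {b} → b ≢ root → depth b ∸ depth (parent b) ≡ 1
  depth-parent∸self {b} b≢r = trans (depth-parent∸ b≢r ≤-refl) (cong suc (n∸n≡0 (depth (parent b))))

  ∸depth-parent : ∀ {b d} → b ≢ root → depth b ≤ d →
                  d ∸ depth (parent b) ≡ suc (d ∸ depth b)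
  ∸depth-parent {b} {d} b≢r b≤d =
    trans (m∸n≡suc[m∸suc[n]] (<-≤-trans (depth-parent< b≢r) b≤d))
          (cong (λ e → suc (d ∸ e)) (sym (depth-parent b b≢r)))

  parent≢ : ∀ {b} → b ≢ root → parent b ≢ b
  parent≢ b≢r e = <-irrefl (cong depth e) (depth-parent< b≢r)

  Anc-parent : ∀ {b} → b ≢ root → Anc T (parent b) b
  Anc-parent b≢r = anc-step b≢r anc-refl

  Anc-trans : ∀ {a b c} → Anc T a b → Anc T b c → Anc T a c
  Anc-trans ab anc-refl = ab
  Anc-trans ab (anc-step c≢r bpc) = anc-step c≢r (Anc-trans ab bpc)

  Anc⇒depth≤ : ∀ {a b} → Anc T a b → depth a ≤ depth b
  Anc⇒depth≤ anc-refl = ≤-refl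
  Anc⇒depth≤ (anc-step b≢r apb) = ≤-trans (Anc⇒depth≤ apb) (<⇒≤ (depth-parent< b≢r))

  Anc-nonroot : ∀ {a b} → Anc T a b → a ≢ b → b ≢ root
  Anc-nonroot anc-refl a≢a = ⊥-elim (a≢a refl)
  Anc-nonroot (anc-step b≢r _) _ = b≢r

  Anc-to-parent : ∀ {a b} → Anc T a b → a ≢ b → Anc T a (parent b)
  Anc-to-parent anc-refl a≢a = ⊥-elim (a≢a refl)
  Anc-to-parent (anc-step _ apb) _ = apb

  Anc⇒depth< : ∀ {a b} → Anc T a b → a ≢ b → depth a < depth b
  Anc⇒depth< ab a≢b =
    ≤-<-trans (Anc⇒depth≤ (Anc-to-parent ab a≢b)) (depth-parent< (Anc-nonroot ab a≢b))

  Anc-antisym : ∀ {a b} → Anc T a b → Anc T b a → a ≡ b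
  Anc-antisym anc-refl _ = refl
  Anc-antisym (anc-step b≢r apb) ba =
    ⊥-elim (<⇒≱ (≤-<-trans (Anc⇒depth≤ apb) (depth-parent< b≢r)) (Anc⇒depth≤ ba))

  ¬Anc-parent : ∀ {a} → a ≢ root → ¬ Anc T a (parent a)
  ¬Anc-parent a≢r a≼pa = <⇒≱ (depth-parent< a≢r) (Anc⇒depth≤ a≼pa)

  strict-descendant≢ : ∀ {m v u} → Anc T m v → Anc T v u → v ≢ u → u ≢ m
  strict-descendant≢ {v = v} mv vu v≢u u≡m =
    <⇒≱ (Anc⇒depth< vu v≢u) (subst (λ x → depth x ≤ depth v) (sym u≡m) (Anc⇒depth≤ mv))

  Anc-total : ∀ {a b x} → Anc T a x → Anc T b x → Anc T a b ⊎ Anc T b a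
  Anc-total anc-refl bx = inj₂ bx
  Anc-total ax@(anc-step _ _) anc-refl = inj₁ ax
  Anc-total (anc-step _ apx) (anc-step _ bpx) = Anc-total apx bpx

  child-towards : ∀ {m x} → Anc T m x → m ≢ x →
                  Σ (Fin n) λ c → c ≢ root × parent c ≡ m × Anc T c x
  child-towards anc-refl m≢m = ⊥-elim (m≢m refl)
  child-towards {m} (anc-step {y} y≢r mpy) _ with parent y ≟ m
  ... | yes py≡m = y , y≢r , py≡m , anc-refl
  ... | no py≢m with child-towards mpy (py≢m ∘ sym)
  ... | c , c≢r , pc≡m , cpy = c , c≢r , pc≡m , anc-step y≢r cpy

  IsLCA-unique : ∀ {m m' u w} → IsLCA T m u w → IsLCA T m' u w → m ≡ m'
  IsLCA-unique (mu , mw , m-max) (m'u , m'w , m'-max) =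
    Anc-antisym (m'-max _ mu mw) (m-max _ m'u m'w)

  common-ancestor≡lca : ∀ {m u w a} → IsLCA T m u w → Anc T a u → Anc T a w → Anc T m a → a ≡ m
  common-ancestor≡lca (_ , _ , m-max) au aw ma = Anc-antisym (m-max _ au aw) ma

  IsLCA-parentˡ : ∀ {m u w} → IsLCA T m u w → u ≢ m → IsLCA T m (parent u) w
  IsLCA-parentˡ (mu , mw , m-max) u≢m =
    Anc-to-parent mu (u≢m ∘ sym) , mw ,
    λ c cpu cw → m-max c (Anc-trans cpu (Anc-parent (Anc-nonroot mu (u≢m ∘ sym)))) cw

  IsLCA-parentʳ : ∀ {m u w} → IsLCA T m u w → w ≢ m → IsLCA T m u (parent w)
  IsLCA-parentʳ (mu , mw , m-max) w≢m =
    mu , Anc-to-parent mw (w≢m ∘ sym) ,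
    λ c cu cpw → m-max c cu (Anc-trans cpw (Anc-parent (Anc-nonroot mw (w≢m ∘ sym))))

  IsLCA-ancestorˡ : ∀ {x w} → Anc T x w → IsLCA T x x w
  IsLCA-ancestorˡ xw = anc-refl , xw , λ _ cx _ → cx

  IsLCA-ancestorʳ : ∀ {x u} → Anc T x u → IsLCA T x u x
  IsLCA-ancestorʳ xu = xu , anc-refl , λ _ _ cx → cx

module Paths {n : ℕ} (T : RootedOrientedTree n) where
  open RootedOrientedTree T
  open Ancestry T

  pathLength : Fin n → Link n → ℕ
  pathLength m (u , w) = (depth u ∸ depth m) + (depth w ∸ depth m)

  start-side-pos : ∀ {m u w x} → IsLCA T m u w → Anc T m x → Anc T x u →
                   PathPos T (u , w) x (depth u ∸ depth x)
  start-side-pos lca mx xu = _ , lca , inj₁ (mx , xu , refl)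

  end-side-pos : ∀ {m u w x} → IsLCA T m u w → Anc T m x → Anc T x w →
                 PathPos T (u , w) x ((depth u ∸ depth m) + (depth x ∸ depth m))
  end-side-pos lca mx xw = _ , lca , inj₂ (mx , xw , refl)

  inner⇒2≤pathLength : ∀ {m u w v} → IsLCA T m u w → Anc T m v → Anc T v u ⊎ Anc T v w →
                       v ≢ u → v ≢ w → 2 ≤ pathLength m (u , w)
  inner⇒2≤pathLength {m} {v = v} (mu , mw , _) mv side v≢u v≢w with v ≟ m | side
  ... | yes refl | _ =
    +-mono-≤ (m<n⇒0<n∸m (Anc⇒depth< mu v≢u)) (m<n⇒0<n∸m (Anc⇒depth< mw v≢w))
  ... | no v≢m | inj₁ vu =
    ≤-trans (2≤∸ (Anc⇒depth< mv (v≢m ∘ sym)) (Anc⇒depth< vu v≢u)) (m≤m+n _ _)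
  ... | no v≢m | inj₂ vw =
    ≤-trans (2≤∸ (Anc⇒depth< mv (v≢m ∘ sym)) (Anc⇒depth< vw v≢w)) (m≤n+m _ _)

  CoversVia : Fin n → Link n → Fin n → Set
  CoversVia m (u , w) a =
    (Anc T a u × a ≢ m × Anc T m a × towardRoot a ≡ false)
    ⊎ (Anc T a w × a ≢ m × Anc T m a × towardRoot a ≡ true)

  covers-via : ∀ {m u w a} → IsLCA T m u w → Covers T (u , w) a → CoversVia m (u , w) a
  covers-via lca (_ , _ , lca' , via) with IsLCA-unique lca' lca
  ... | refl = via

  covered-off-end⇒down : ∀ {u w a} → ¬ Anc T a w → Covers T (u , w) a → towardRoot a ≡ false
  covered-off-end⇒down _ (_ , _ , _ , inj₁ (_ , _ , _ , down)) = down
  covered-off-end⇒down a⋠w (_ , _ , _ , inj₂ (aw , _)) = ⊥-elim (a⋠w aw)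

  covered-off-start⇒up : ∀ {u w a} → ¬ Anc T a u → Covers T (u , w) a → towardRoot a ≡ true
  covered-off-start⇒up a⋠u (_ , _ , _ , inj₁ (au , _)) = ⊥-elim (a⋠u au)
  covered-off-start⇒up _ (_ , _ , _ , inj₂ (_ , _ , _ , up)) = up

  start⋠end : ∀ {m u w} → IsLCA T m u w → u ≢ m → ¬ Anc T u w
  start⋠end lca u≢m uw = u≢m (common-ancestor≡lca lca anc-refl uw (proj₁ lca))

  end⋠start : ∀ {m u w} → IsLCA T m u w → w ≢ m → ¬ Anc T w u
  end⋠start lca w≢m wu = w≢m (common-ancestor≡lca lca wu anc-refl (proj₁ (proj₂ lca)))

  record Trimming (ℓ : Link n) (b : Fin n) : Set where
    field
      shadow     : Link n
      is-shadow  : Shadow T ℓ shadow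
      strict     : shadow ≢ ℓ
      loses-only : ∀ {a} → Covers T ℓ a → Covers T shadow a ⊎ a ≡ b

  trim-start : ∀ {m u w} → IsLCA T m u w → u ≢ m → 2 ≤ pathLength m (u , w) →
               Trimming (u , w) u
  trim-start {m} {u} {w} lca@(mu , mw , _) u≢m 2≤len = record
    { shadow     = parent u , w
    ; is-shadow  = _ , _ , start-side-pos lca mpu (Anc-parent u≢r) , end-side-pos lca mw anc-refl
                 , subst (_< pathLength m (u , w)) (sym (depth-parent∸self u≢r)) 2≤len
    ; strict     = parent≢ u≢r ∘ cong proj₁
    ; loses-only = keeps
    }
    where
    u≢r = Anc-nonroot mu (u≢m ∘ sym)
    mpu = Anc-to-parent mu (u≢m ∘ sym)
    keeps : ∀ {a} → Covers T (u , w) a → Covers T (parent u , w) a ⊎ a ≡ u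
    keeps {a} cov@(a≢r , _) with a ≟ u | covers-via lca cov
    ... | yes a≡u | _ = inj₂ a≡u
    ... | no a≢u | inj₁ (au , on-start) =
      inj₁ (a≢r , m , IsLCA-parentˡ lca u≢m , inj₁ (Anc-to-parent au a≢u , on-start))
    ... | no _ | inj₂ on-end = inj₁ (a≢r , m , IsLCA-parentˡ lca u≢m , inj₂ on-end)

  trim-end : ∀ {m u w} → IsLCA T m u w → w ≢ m → 2 ≤ pathLength m (u , w) →
             Trimming (u , w) w
  trim-end {m} {u} {w} lca@(mu , mw , _) w≢m 2≤len = record
    { shadow     = u , parent w
    ; is-shadow  = _ , _ , start-side-pos lca mu anc-refl , end-side-pos lca mpw (Anc-parent w≢r)
                 , subst (_< pathLength m (u , parent w)) (sym (n∸n≡0 (depth u)))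
                         (≤-pred (subst (2 ≤_) len≡ 2≤len))
    ; strict     = parent≢ w≢r ∘ cong proj₂
    ; loses-only = keeps
    }
    where
    w≢r = Anc-nonroot mw (w≢m ∘ sym)
    mpw = Anc-to-parent mw (w≢m ∘ sym)
    len≡ : pathLength m (u , w) ≡ suc (pathLength m (u , parent w))
    len≡ = trans (cong (depth u ∸ depth m +_) (depth-parent∸ w≢r (Anc⇒depth≤ mpw))) (+-suc _ _)
    keeps : ∀ {a} → Covers T (u , w) a → Covers T (u , parent w) a ⊎ a ≡ w
    keeps {a} cov@(a≢r , _) with a ≟ w | covers-via lca cov
    ... | yes a≡w | _ = inj₂ a≡w
    ... | no _ | inj₁ on-start = inj₁ (a≢r , m , IsLCA-parentʳ lca w≢m , inj₁ on-start)
    ... | no a≢w | inj₂ (aw , on-end) =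
      inj₁ (a≢r , m , IsLCA-parentʳ lca w≢m , inj₂ (Anc-to-parent aw a≢w , on-end))

  trim-lca-start : ∀ {u w x} → IsLCA T u u w → x ≢ root → parent x ≡ u → Anc T x w →
                   2 ≤ pathLength u (u , w) → Trimming (u , w) x
  trim-lca-start {w = w} {x} lca x≢r refl xw 2≤len = record
    { shadow     = x , w
    ; is-shadow  = _ , _ , end-side-pos lca (Anc-parent x≢r) xw
                 , end-side-pos lca (proj₁ (proj₂ lca)) anc-refl
                 , subst (_< pathLength (parent x) (parent x , w))
                         (sym (cong₂ _+_ (n∸n≡0 (depth (parent x))) (depth-parent∸self x≢r))) 2≤len
    ; strict     = parent≢ x≢r ∘ sym ∘ cong proj₁
    ; loses-only = keeps
    }
    where
    keeps : ∀ {a} → Covers T (parent x , w) a → Covers T (x , w) a ⊎ a ≡ x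
    keeps {a} cov@(a≢r , _) with covers-via lca cov
    ... | inj₁ (a≼px , a≢px , px≼a , _) = ⊥-elim (a≢px (Anc-antisym a≼px px≼a))
    ... | inj₂ (aw , a≢px , px≼a , up) with a ≟ x
    ...   | yes a≡x = inj₂ a≡x
    ...   | no a≢x with Anc-total aw xw
    ...     | inj₁ ax = ⊥-elim (a≢px (Anc-antisym (Anc-to-parent ax a≢x) px≼a))
    ...     | inj₂ xa = inj₁ (a≢r , x , IsLCA-ancestorˡ xw , inj₂ (aw , a≢x , xa , up))

  trim-lca-end : ∀ {u w x} → IsLCA T w u w → x ≢ root → parent x ≡ w → Anc T x u →
                 2 ≤ pathLength w (u , w) → Trimming (u , w) x
  trim-lca-end {u} {x = x} lca x≢r refl xu 2≤len = record
    { shadow     = u , x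
    ; is-shadow  = _ , _ , start-side-pos lca (proj₁ lca) anc-refl , start-side-pos lca (Anc-parent x≢r) xu
                 , subst (_< depth u ∸ depth x) (sym (n∸n≡0 (depth u)))
                         (≤-pred (subst (2 ≤_) len≡ 2≤len))
    ; strict     = parent≢ x≢r ∘ sym ∘ cong proj₂
    ; loses-only = keeps
    }
    where
    len≡ : pathLength (parent x) (u , parent x) ≡ suc (depth u ∸ depth x)
    len≡ = trans (cong (depth u ∸ depth (parent x) +_) (n∸n≡0 (depth (parent x))))
                 (trans (+-identityʳ _) (∸depth-parent x≢r (Anc⇒depth≤ xu)))
    keeps : ∀ {a} → Covers T (u , parent x) a → Covers T (u , x) a ⊎ a ≡ x
    keeps {a} cov@(a≢r , _) with covers-via lca cov
    ... | inj₂ (a≼px , a≢px , px≼a , _) = ⊥-elim (a≢px (Anc-antisym a≼px px≼a))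
    ... | inj₁ (au , a≢px , px≼a , down) with a ≟ x
    ...   | yes a≡x = inj₂ a≡x
    ...   | no a≢x with Anc-total au xu
    ...     | inj₁ ax = ⊥-elim (a≢px (Anc-antisym (Anc-to-parent ax a≢x) px≼a))
    ...     | inj₂ xa = inj₁ (a≢r , x , IsLCA-ancestorʳ xu , inj₁ (au , a≢x , xa , down))

  PosAtMost PosAtLeast : Link n → Fin n → ℕ → Set
  PosAtMost ℓ x p = Σ ℕ λ q → PathPos T ℓ x q × q ≤ p
  PosAtLeast ℓ x p = Σ ℕ λ q → PathPos T ℓ x q × p ≤ q

  CoveredArcBefore CoveredArcAfter : Link n → ℕ → Set
  CoveredArcBefore ℓ p = Σ (Fin n) λ a → Covers T ℓ a × PosAtMost ℓ a p × PosAtMost ℓ (parent a) p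
  CoveredArcAfter ℓ p = Σ (Fin n) λ a → Covers T ℓ a × PosAtLeast ℓ a p × PosAtLeast ℓ (parent a) p

  innerPbar : ∀ {ℓ v p} → PathPos T ℓ v p → CoveredArcBefore ℓ p → CoveredArcAfter ℓ p →
              InnerPbar T ℓ v
  innerPbar {p = p} v-pos (a₁ , cov₁ , (p₁ , pos₁ , p₁≤p) , (q₁ , pos₁' , q₁≤p))
                          (a₂ , cov₂ , (p₂ , pos₂ , p≤p₂) , (q₂ , pos₂' , p≤q₂)) =
    a₁ , a₂ , p , p₁ , q₁ , p₂ , q₂ , cov₁ , cov₂ , v-pos ,
    pos₁ , pos₁' , p₁≤p , q₁≤p , pos₂ , pos₂' , p≤p₂ , p≤q₂

  start-side-before : ∀ {m u w x y} → IsLCA T m u w → Anc T m y → Anc T y x → Anc T x u →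
                      PosAtMost (u , w) x (depth u ∸ depth y)
  start-side-before lca my yx xu =
    _ , start-side-pos lca (Anc-trans my yx) xu , ∸-monoʳ-≤ _ (Anc⇒depth≤ yx)

  start-side-after : ∀ {m u w x y} → IsLCA T m u w → Anc T m x → Anc T x y → Anc T y u →
                     PosAtLeast (u , w) x (depth u ∸ depth y)
  start-side-after lca mx xy yu =
    _ , start-side-pos lca mx (Anc-trans xy yu) , ∸-monoʳ-≤ _ (Anc⇒depth≤ xy)

  end-side-before : ∀ {m u w x y} → IsLCA T m u w → Anc T m x → Anc T x y → Anc T y w →
                    PosAtMost (u , w) x ((depth u ∸ depth m) + (depth y ∸ depth m))
  end-side-before {m} {u} lca mx xy yw =
    _ , end-side-pos lca mx (Anc-trans xy yw) ,
    +-monoʳ-≤ (depth u ∸ depth m) (∸-monoˡ-≤ (depth m) (Anc⇒depth≤ xy))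

  end-side-after : ∀ {m u w x y} → IsLCA T m u w → Anc T m y → Anc T y x → Anc T x w →
                   PosAtLeast (u , w) x ((depth u ∸ depth m) + (depth y ∸ depth m))
  end-side-after {m} {u} lca my yx xw =
    _ , end-side-pos lca (Anc-trans my yx) xw ,
    +-monoʳ-≤ (depth u ∸ depth m) (∸-monoˡ-≤ (depth m) (Anc⇒depth≤ yx))

  start-before-end : ∀ {m u w x} → IsLCA T m u w → Anc T m x → Anc T x u →
                     ∀ d → PosAtMost (u , w) x ((depth u ∸ depth m) + d)
  start-before-end lca mx xu _ =
    _ , start-side-pos lca mx xu , ≤-trans (∸-monoʳ-≤ _ (Anc⇒depth≤ mx)) (m≤m+n _ _)

  end-after-start : ∀ {m u w x y} → IsLCA T m u w → Anc T m y → Anc T m x → Anc T x w →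
                    PosAtLeast (u , w) x (depth u ∸ depth y)
  end-after-start lca my mx xw =
    _ , end-side-pos lca mx xw , ≤-trans (∸-monoʳ-≤ _ (Anc⇒depth≤ my)) (m≤m+n _ _)

module Keys {n : ℕ} (T : RootedOrientedTree n) {P : Link n → Set} (key : Link n → Fin n)
  (key≢root : ∀ {ℓ} → P ℓ → key ℓ ≢ RootedOrientedTree.root T)
  (incomparable : ∀ {ℓ ℓ'} → P ℓ → P ℓ' → ℓ ≢ ℓ' → ¬ Anc T (key ℓ') (key ℓ)) where
  open RootedOrientedTree T
  open Ancestry T

  keys-unique : ∀ {ℓs} → Unique ℓs → All P ℓs → Unique (map key ℓs)
  keys-unique [] [] = []
  keys-unique (ℓ∉ℓs ∷ uniq) (p ∷ ps) =
    All-map⁺ (All.zipWith distinct-keys (ℓ∉ℓs , ps)) ∷ keys-unique uniq ps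
    where
    distinct-keys : ∀ {ℓ'} → _ ≢ ℓ' × P ℓ' → key _ ≢ key ℓ'
    distinct-keys (ℓ≢ℓ' , p') e = incomparable p p' ℓ≢ℓ' (subst (Anc T _) (sym e) anc-refl)

  keys-ancestorFree : ∀ {ℓs} → All P ℓs → AncestorFree T (map key ℓs)
  keys-ancestorFree ps a a' a∈ a'∈ a'≼pa with ∈-map⁻ key a∈ | ∈-map⁻ key a'∈
  ... | ℓ , ℓ∈ , refl | ℓ' , ℓ'∈ , refl with key ℓ ≟ key ℓ'
  ...   | yes e = ¬Anc-parent (key≢root (All.lookup ps ℓ∈))
                    (subst (λ x → Anc T x (parent (key ℓ))) (sym e) a'≼pa)
  ...   | no ne = incomparable (All.lookup ps ℓ∈) (All.lookup ps ℓ'∈) (ne ∘ cong key)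
                    (Anc-trans a'≼pa (Anc-parent (key≢root (All.lookup ps ℓ∈))))

module Minimality {n : ℕ} (T : RootedOrientedTree n) (L F : Link n → Set)
  (F⊆L : ∀ ℓ → F ℓ → L ℓ) (shadows-in-L : ∀ {ℓ ℓ'} → F ℓ → Shadow T ℓ ℓ' → L ℓ')
  (feasible : Feasible T F) (minimal : ShadowMinimal T L F) where
  open RootedOrientedTree T
  open Ancestry T
  open Paths T

  CoveredElsewhere : Link n → Fin n → Set
  CoveredElsewhere ℓ b = Σ (Link n) λ ℓ' → F ℓ' × ℓ' ≢ ℓ × Covers T ℓ' b

  trimmed-arc-essential : ∀ {ℓ b} → F ℓ → Trimming ℓ b → ¬ (Covers T ℓ b → CoveredElsewhere ℓ b)
  trimmed-arc-essential {ℓ} Fℓ t elsewhere =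
    minimal ℓ shadow Fℓ (shadows-in-L Fℓ is-shadow) is-shadow strict replaced-feasible
    where
    open Trimming t
    replaced-feasible : Feasible T (λ m → (F m × m ≢ ℓ) ⊎ m ≡ shadow)
    replaced-feasible a a≢r with feasible a a≢r
    ... | ℓ' , Fℓ' , cov with ≡-dec _≟_ _≟_ ℓ' ℓ
    ...   | no ℓ'≢ℓ = ℓ' , inj₁ (Fℓ' , ℓ'≢ℓ) , cov
    ...   | yes refl with loses-only cov
    ...     | inj₁ cov' = shadow , inj₂ refl , cov'
    ...     | inj₂ refl with elsewhere cov
    ...       | ℓ'' , Fℓ'' , ℓ''≢ℓ , cov'' = ℓ'' , inj₁ (Fℓ'' , ℓ''≢ℓ) , cov''

  trimmed-arc-orientation : ∀ {ℓ b β} → F ℓ → Trimming ℓ b →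
                            (Covers T ℓ b → towardRoot b ≡ β) → towardRoot b ≡ β
  trimmed-arc-orientation {b = b} {β} Fℓ t orientation =
    decidable-stable (towardRoot b ≟ᵇ β) λ ≢β →
      trimmed-arc-essential Fℓ t (⊥-elim ∘ ≢β ∘ orientation)

  trimmed-arc-not-covered-elsewhere : ∀ {ℓ b} → F ℓ → Trimming ℓ b → ¬ CoveredElsewhere ℓ b
  trimmed-arc-not-covered-elsewhere Fℓ t elsewhere = trimmed-arc-essential Fℓ t λ _ → elsewhere

  start-arc-down : ∀ {m u w} → F (u , w) → IsLCA T m u w → u ≢ m → 2 ≤ pathLength m (u , w) →
                   towardRoot u ≡ false
  start-arc-down Fℓ lca u≢m 2≤len =
    trimmed-arc-orientation Fℓ (trim-start lca u≢m 2≤len) (covered-off-end⇒down (start⋠end lca u≢m))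

  end-arc-up : ∀ {m u w} → F (u , w) → IsLCA T m u w → w ≢ m → 2 ≤ pathLength m (u , w) →
               towardRoot w ≡ true
  end-arc-up Fℓ lca w≢m 2≤len =
    trimmed-arc-orientation Fℓ (trim-end lca w≢m 2≤len) (covered-off-start⇒up (end⋠start lca w≢m))

  start-arc-covered : ∀ {m u w} → F (u , w) → IsLCA T m u w → u ≢ m → 2 ≤ pathLength m (u , w) →
                      Covers T (u , w) u
  start-arc-covered Fℓ lca@(mu , _) u≢m 2≤len =
    Anc-nonroot mu (u≢m ∘ sym) , _ , lca , inj₁ (anc-refl , u≢m , mu , start-arc-down Fℓ lca u≢m 2≤len)

  end-arc-covered : ∀ {m u w} → F (u , w) → IsLCA T m u w → w ≢ m → 2 ≤ pathLength m (u , w) →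
                    Covers T (u , w) w
  end-arc-covered Fℓ lca@(_ , mw , _) w≢m 2≤len =
    Anc-nonroot mw (w≢m ∘ sym) , _ , lca , inj₂ (anc-refl , w≢m , mw , end-arc-up Fℓ lca w≢m 2≤len)

  lca-start-child-covered : ∀ {u w x} → F (u , w) → IsLCA T u u w → x ≢ root → parent x ≡ u →
                            Anc T x w → 2 ≤ pathLength u (u , w) → Covers T (u , w) x
  lca-start-child-covered Fℓ lca x≢r refl xw 2≤len =
    x≢r , _ , lca , inj₂ (xw , parent≢ x≢r ∘ sym , Anc-parent x≢r ,
      trimmed-arc-orientation Fℓ (trim-lca-start lca x≢r refl xw 2≤len)
        (covered-off-start⇒up (¬Anc-parent x≢r)))

  lca-end-child-covered : ∀ {u w x} → F (u , w) → IsLCA T w u w → x ≢ root → parent x ≡ w →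
                          Anc T x u → 2 ≤ pathLength w (u , w) → Covers T (u , w) x
  lca-end-child-covered Fℓ lca x≢r refl xu 2≤len =
    x≢r , _ , lca , inj₁ (xu , parent≢ x≢r ∘ sym , Anc-parent x≢r ,
      trimmed-arc-orientation Fℓ (trim-lca-end lca x≢r refl xu 2≤len)
        (covered-off-end⇒down (¬Anc-parent x≢r)))

  StartsBelow EndsBelow : Fin n → Link n → Set
  StartsBelow v (u , w) =
    F (u , w) × Σ (Fin n) λ m → IsLCA T m u w × Anc T m v × Anc T v u × v ≢ u × v ≢ w
  EndsBelow v (u , w) =
    F (u , w) × Σ (Fin n) λ m → IsLCA T m u w × Anc T m v × Anc T v w × v ≢ u × v ≢ w

  inner-link-classify : ∀ {v ℓ} → F ℓ × InnerP T ℓ v → StartsBelow v ℓ ⊎ EndsBelow v ℓ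
  inner-link-classify {ℓ = _ , _} (Fℓ , (_ , m , lca , inj₁ (mv , vu , _)) , v≢u , v≢w) =
    inj₁ (Fℓ , m , lca , mv , vu , v≢u , v≢w)
  inner-link-classify {ℓ = _ , _} (Fℓ , (_ , m , lca , inj₂ (mv , vw , _)) , v≢u , v≢w) =
    inj₂ (Fℓ , m , lca , mv , vw , v≢u , v≢w)

  last-arc-after-start-side : ∀ {m u w v} → F (u , w) → IsLCA T m u w → Anc T m v → Anc T v u →
                              v ≢ w → 2 ≤ pathLength m (u , w) →
                              CoveredArcAfter (u , w) (depth u ∸ depth v)
  last-arc-after-start-side {m} {w = w} Fℓ lca@(_ , mw , _) mv vu v≢w 2≤len with w ≟ m
  ... | no w≢m =
    w , end-arc-covered Fℓ lca w≢m 2≤len , end-after-start lca mv mw anc-refl ,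
    end-after-start lca mv (Anc-to-parent mw (w≢m ∘ sym)) (Anc-parent (Anc-nonroot mw (w≢m ∘ sym)))
  ... | yes refl with child-towards mv (v≢w ∘ sym)
  ...   | x , x≢r , refl , xv =
    x , lca-end-child-covered Fℓ lca x≢r refl (Anc-trans xv vu) 2≤len ,
    start-side-after lca (Anc-parent x≢r) xv vu ,
    start-side-after lca anc-refl (Anc-trans (Anc-parent x≢r) xv) vu

  first-arc-before-end-side : ∀ {m u w v} → F (u , w) → IsLCA T m u w → Anc T m v → Anc T v w →
                              v ≢ u → 2 ≤ pathLength m (u , w) →
                              CoveredArcBefore (u , w) ((depth u ∸ depth m) + (depth v ∸ depth m))
  first-arc-before-end-side {m} {u} Fℓ lca@(mu , _) mv vw v≢u 2≤len with u ≟ m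
  ... | no u≢m =
    u , start-arc-covered Fℓ lca u≢m 2≤len , start-before-end lca mu anc-refl _ ,
    start-before-end lca (Anc-to-parent mu (u≢m ∘ sym)) (Anc-parent (Anc-nonroot mu (u≢m ∘ sym))) _
  ... | yes refl with child-towards mv (v≢u ∘ sym)
  ...   | x , x≢r , refl , xv =
    x , lca-start-child-covered Fℓ lca x≢r refl (Anc-trans xv vw) 2≤len ,
    end-side-before lca (Anc-parent x≢r) xv vw ,
    end-side-before lca anc-refl (Anc-trans (Anc-parent x≢r) xv) vw

  start-visible-down : ∀ {v ℓ} → StartsBelow v ℓ →
                       Visible T L v (proj₁ ℓ) × towardRoot (proj₁ ℓ) ≡ false
  start-visible-down {ℓ = u , w} (Fℓ , m , lca , mv , vu , v≢u , v≢w) =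
    (u≢r , vu , v≢u ∘ sym , (u , w) , F⊆L _ Fℓ , start-covered ,
      innerPbar (start-side-pos lca mv vu)
        (u , start-covered , start-side-before lca mv vu anc-refl ,
             start-side-before lca mv (Anc-to-parent vu v≢u) (Anc-parent u≢r))
        (last-arc-after-start-side Fℓ lca mv vu v≢w 2≤len)) ,
    start-arc-down Fℓ lca u≢m 2≤len
    where
    u≢r = Anc-nonroot vu v≢u
    u≢m = strict-descendant≢ mv vu v≢u
    2≤len = inner⇒2≤pathLength lca mv (inj₁ vu) v≢u v≢w
    start-covered = start-arc-covered Fℓ lca u≢m 2≤len

  end-visible-up : ∀ {v ℓ} → EndsBelow v ℓ →
                   Visible T L v (proj₂ ℓ) × towardRoot (proj₂ ℓ) ≡ true
  end-visible-up {ℓ = u , w} (Fℓ , m , lca , mv , vw , v≢u , v≢w) =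
    (w≢r , vw , v≢w ∘ sym , (u , w) , F⊆L _ Fℓ , end-covered ,
      innerPbar (end-side-pos lca mv vw)
        (first-arc-before-end-side Fℓ lca mv vw v≢u 2≤len)
        (w , end-covered , end-side-after lca mv vw anc-refl ,
             end-side-after lca mv (Anc-to-parent vw v≢w) (Anc-parent w≢r))) ,
    end-arc-up Fℓ lca w≢m 2≤len
    where
    w≢r = Anc-nonroot vw v≢w
    w≢m = strict-descendant≢ mv vw v≢w
    2≤len = inner⇒2≤pathLength lca mv (inj₂ vw) v≢u v≢w
    end-covered = end-arc-covered Fℓ lca w≢m 2≤len

  starts-incomparable : ∀ {v ℓ ℓ'} → StartsBelow v ℓ → StartsBelow v ℓ' → ℓ ≢ ℓ' →
                        ¬ Anc T (proj₁ ℓ') (proj₁ ℓ)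
  starts-incomparable {ℓ = u , w} (Fℓ , m , lca , mv , _)
                      sb'@(Fℓ' , m' , lca' , mv' , vu' , v≢u' , v≢w') ℓ≢ℓ' u'≼u =
    trimmed-arc-not-covered-elsewhere Fℓ'
      (trim-start lca' (strict-descendant≢ mv' vu' v≢u')
                  (inner⇒2≤pathLength lca' mv' (inj₁ vu') v≢u' v≢w'))
      ((u , w) , Fℓ , ℓ≢ℓ' , Anc-nonroot vu' v≢u' , m , lca ,
        inj₁ (u'≼u , strict-descendant≢ mv vu' v≢u' , Anc-trans mv vu' , proj₂ (start-visible-down sb')))

  ends-incomparable : ∀ {v ℓ ℓ'} → EndsBelow v ℓ → EndsBelow v ℓ' → ℓ ≢ ℓ' →
                      ¬ Anc T (proj₂ ℓ') (proj₂ ℓ)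
  ends-incomparable {ℓ = u , w} (Fℓ , m , lca , mv , _)
                    eb'@(Fℓ' , m' , lca' , mv' , vw' , v≢u' , v≢w') ℓ≢ℓ' w'≼w =
    trimmed-arc-not-covered-elsewhere Fℓ'
      (trim-end lca' (strict-descendant≢ mv' vw' v≢w')
                (inner⇒2≤pathLength lca' mv' (inj₂ vw') v≢u' v≢w'))
      ((u , w) , Fℓ , ℓ≢ℓ' , Anc-nonroot vw' v≢w' , m , lca ,
        inj₂ (w'≼w , strict-descendant≢ mv vw' v≢w' , Anc-trans mv vw' , proj₂ (end-visible-up eb')))

  starts-bound : ∀ {k} → VisibleWidthAtMost T L k → ∀ v {ℓs} → Unique ℓs → All (StartsBelow v) ℓs →
                 length ℓs ≤ k
  starts-bound VW v {ℓs} uniq sbs =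
    subst (_≤ _) (length-map proj₁ ℓs)
      (VW v (map proj₁ ℓs) (keys-unique uniq sbs) (keys-ancestorFree sbs)
          (inj₂ (All-map⁺ (All.map start-visible-down sbs))))
    where
    open Keys T {StartsBelow v} proj₁ (λ sb → proj₁ (proj₁ (start-visible-down sb))) starts-incomparable

  ends-bound : ∀ {k} → VisibleWidthAtMost T L k → ∀ v {ℓs} → Unique ℓs → All (EndsBelow v) ℓs →
               length ℓs ≤ k
  ends-bound VW v {ℓs} uniq ebs =
    subst (_≤ _) (length-map proj₂ ℓs)
      (VW v (map proj₂ ℓs) (keys-unique uniq ebs) (keys-ancestorFree ebs)
          (inj₁ (All-map⁺ (All.map end-visible-up ebs))))
    where
    open Keys T {EndsBelow v} proj₂ (λ eb → proj₁ (proj₁ (end-visible-up eb))) ends-incomparable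

lemma6p5 : ∀ {n : ℕ} (T : RootedOrientedTree n) (L : Link n → Set) (c : Link n → ℚ) →
    (∀ ℓ → L ℓ → 0ℚ <ℚ c ℓ) → (k : ℕ) →
    ShadowComplete T L c → VisibleWidthAtMost T L k →
    (F : Link n → Set) → (∀ ℓ → F ℓ → L ℓ) → Feasible T F → ShadowMinimal T L F →
    Thin T F (2 * k)
lemma6p5 T L c _ k complete VW F F⊆L feasible minimal v S uniq inner = begin
  length S                      ≡⟨ length-split ⟩
  length lefts + length rights  ≤⟨ +-mono-≤ (starts-bound VW v (Unique-resp-⊆ lefts⊆ uniq) all-lefts)
                                            (ends-bound VW v (Unique-resp-⊆ rights⊆ uniq) all-rights) ⟩
  k + k                         ≡⟨ cong (k +_) (sym (+-identityʳ k)) ⟩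
  2 * k                         ∎
  where
  open ≤-Reasoning
  open Minimality T L F F⊆L (λ Fℓ sh → proj₁ (complete _ _ (F⊆L _ Fℓ) sh)) feasible minimal
  open Split (split S (All.map inner-link-classify inner))
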